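{- Let $T$ be a marriage instance, $T'\subseteq T$ a stable table, and let $\rho\in R_X(T')$ be exposed in $M^0\in\mathcal{S}(T')$. Let $M^*=M^0/\rho$ and $\tilde T=\{xy\in T: x\in X,\ y\in Y,\ M^*(y)\ge_y x\ge_y M^0(y)\text{ and } M^0(x)\ge_x y\ge_x M^*(x)\}$. Then: 1. Let $\rho^g\ne\rho$ be a generalized $X$-rotation exposed in $M^0$ within $\tilde T$, $M^1=M^0/\rho^g$, and $\overline T=T'\cup E(\rho^g)$. Then (a) $M^1\notin\mathcal{S}(T')$, (b) $\{M^1\}\cup\mathcal{S}(T')$ is internally stable, (c) $M^0\succ_XM^1\succ_XM^*$, (d) $M^0\in\mathcal{S}(\overline T)$, and (e) $\rho^g\in R_X(\overline T)$ and $\rho^g$ is exposed in $M^0$. 2. Conversely, let $M^1\subseteq T$ be a matching such that $M^0\succ_XM^1\succ_XM^*$ and $\{M^1\}\cup\mathcal{S}(T')$ is internally stable. Then there exists a generalized $X$-rotation $\rho^g\ne\rho$ exposed in $M^0$ within $\tilde T$.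
   Context: Marriage instance: agents partitioned into $X,Y$, each agent has a strict order $>_z$ (with weak version $\ge_z$) over its acceptable agents on the other side, acceptability symmetric; acceptable pairs are edges. Matchings, $M(z)$ (partner or $\emptyset$, least preferred); an edge $ab$ blocks $M$ if $b>_aM(a)$, $a>_bM(b)$; stable matchings; $\mathcal{S}(U)$ stable matchings of table $U$; a matching $M'$ blocks $M$ if some edge of $M'$ blocks $M$; a set of matchings is internally stable if no two members block each other. Subtable: subset of edges with induced orders; stable table: every edge lies in a stable matching of it. $M\preceq_XM'$ if every $x\in X$ weakly prefers $M'$ to $M$, and $M\prec_XM'$ if also $M\ne M'$. Generalized $X$-rotation exposed in $M$ within $U$: sequence $(x_0,y_0),\dots,(x_{r-1},y_{r-1})$ of distinct agents, indices mod $r$, with $x_iy_i\in M$, $x_iy_{i+1}\in U$, $x_i>_{y_{i+1}}x_{i+1}$, $y_i>_{x_i}y_{i+1}$; an $X$-rotation of $U$ exposed in $M\in\mathcal{S}(U)$ if additionally $M(y)>_yx_i$ for every $y$ with $x_iy\in U$ and $y_i>_{x_i}y>_{x_i}y_{i+1}$. $M/\rho$: each $x_i$ rematched to $y_{i+1}$. $E(\rho)=\{x_iy_i,x_iy_{i+1}\}_i$. $R_X(U)$: $X$-rotations of $U$ exposed in some stable matching of $U$. -}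

module Defs where

open import Data.Nat using (ℕ; zero; suc; _<_; _≤_; _+_)
open import Data.Nat.DivMod using (_mod_)
open import Data.Fin using (Fin; toℕ; _≟_)
open import Data.Fin.Properties using (any?)
open import Data.Bool using (Bool; true; false)
open import Data.Product using (Σ; ∃; _×_; _,_)
open import Data.Sum using (_⊎_)
open import Relation.Nullary using (¬_; Dec; yes; no)
open import Relation.Nullary.Decidable using (⌊_⌋)
open import Relation.Binary.PropositionalEquality using (_≡_)

-- X = Fin m, Y = Fin n.  T x y ≡ true iff xy is an
-- acceptable pair (acceptability is symmetric, so it is a set of edges).
-- Strict preferences are given by ranks: for x, y >_x y' iff
-- rankX x y < rankX x y' (smaller rank = more preferred); ranks are injective
-- on acceptable partners, so each >_z is a strict total order on acceptable agents.
record Instance : Set where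
  field
    m n : ℕ
    T : Fin m → Fin n → Bool
    rankX : Fin m → Fin n → ℕ
    rankY : Fin n → Fin m → ℕ
    rankX-inj : ∀ x y y' → T x y ≡ true → T x y' ≡ true → rankX x y ≡ rankX x y' → y ≡ y'
    rankY-inj : ∀ y x x' → T x y ≡ true → T x' y ≡ true → rankY y x ≡ rankY y x' → x ≡ x'

module _ (I : Instance) where
  open Instance I

  Rel : Set
  Rel = Fin m → Fin n → Bool

  -- tables (edge sets) as predicates; a subtable carries the induced orders
  Table : Set₁
  Table = Fin m → Fin n → Set

  ⟦_⟧ : Rel → Table
  ⟦ R ⟧ x y = R x y ≡ true

  SubtableOf : Table → Table → Set
  SubtableOf U' U = ∀ x y → U' x y → U x y

  IsMatching : Table → Rel → Set
  IsMatching U M =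
    (∀ x y → M x y ≡ true → U x y) ×
    (∀ x y y' → M x y ≡ true → M x y' ≡ true → y ≡ y') ×
    (∀ x x' y → M x y ≡ true → M x' y ≡ true → x ≡ x')

  -- y >_x M(x)   (∅ least preferred)
  PrefX : Rel → Fin m → Fin n → Set
  PrefX M x y = ∀ y' → M x y' ≡ true → rankX x y < rankX x y'

  PrefY : Rel → Fin n → Fin m → Set
  PrefY M y x = ∀ x' → M x' y ≡ true → rankY y x < rankY y x'

  BlocksE : Rel → Fin m → Fin n → Set
  BlocksE M x y = PrefX M x y × PrefY M y x

  Stable : Table → Rel → Set
  Stable U M = IsMatching U M × (∀ x y → U x y → ¬ BlocksE M x y)

  StableTable : Table → Set
  StableTable U = ∀ x y → U x y → ∃ λ M → Stable U M × M x y ≡ true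

  BlocksM : Rel → Rel → Set
  BlocksM M' M = ∃ λ x → ∃ λ y → M' x y ≡ true × BlocksE M x y

  _≐_ : Rel → Rel → Set
  M ≐ M' = ∀ x y → M x y ≡ M' x y

  InternallyStable : (Rel → Set) → Set
  InternallyStable P = ∀ M M' → P M → P M' → ¬ BlocksM M' M

  WeakX : Rel → Rel → Set
  WeakX M M' = ∀ x y → M x y ≡ true → ∃ λ y' → M' x y' ≡ true × rankX x y' ≤ rankX x y

  StrictX : Rel → Rel → Set
  StrictX M M' = WeakX M M' × ¬ (M ≐ M')

  -- a cyclic sequence (x_0,y_0),…,(x_k,y_k) of distinct agents (length r = k+1 ≥ 1)
  record Rot : Set where
    field
      k : ℕ
      xs : Fin (suc k) → Fin m
      ys : Fin (suc k) → Fin n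
      xs-inj : ∀ i j → xs i ≡ xs j → i ≡ j
      ys-inj : ∀ i j → ys i ≡ ys j → i ≡ j

  next : ∀ {k} → Fin (suc k) → Fin (suc k)
  next {k} i = suc (toℕ i) mod suc k

  GenExposed : Table → Rel → Rot → Set
  GenExposed U M ρ = ∀ i →
      M (xs i) (ys i) ≡ true ×
      U (xs i) (ys (next i)) ×
      rankY (ys (next i)) (xs i) < rankY (ys (next i)) (xs (next i)) ×
      rankX (xs i) (ys i) < rankX (xs i) (ys (next i))
    where open Rot ρ

  Exposed : Table → Rel → Rot → Set
  Exposed U M ρ = Stable U M × GenExposed U M ρ ×
      (∀ i y → U (xs i) y →
         rankX (xs i) (ys i) < rankX (xs i) y →
         rankX (xs i) y < rankX (xs i) (ys (next i)) →
         ∃ λ x' → M x' y ≡ true × rankY y x' < rankY y (xs i))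
    where open Rot ρ

  InRX : Table → Rot → Set
  InRX U ρ = ∃ λ M → Exposed U M ρ

  _/_ : Rel → Rot → Rel
  (M / ρ) x y with any? (λ i → Rot.xs ρ i ≟ x)
  ... | yes (i , _) = ⌊ y ≟ Rot.ys ρ (next i) ⌋
  ... | no _ = M x y

  EdgesOf : Rot → Table
  EdgesOf ρ x y = ∃ λ i → xs i ≡ x × (ys i ≡ y ⊎ ys (next i) ≡ y)
    where open Rot ρ

  _∪E_ : Table → Rot → Table
  (U ∪E ρ) x y = U x y ⊎ EdgesOf ρ x y

  -- equality of rotations as cyclic sequences (same length, equal up to a cyclic shift)
  xAt : Rot → ℕ → Fin m
  xAt ρ j = Rot.xs ρ (j mod suc (Rot.k ρ))

  yAt : Rot → ℕ → Fin n
  yAt ρ j = Rot.ys ρ (j mod suc (Rot.k ρ))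

  SameRot : Rot → Rot → Set
  SameRot ρ σ = Rot.k ρ ≡ Rot.k σ × ∃ λ s → ∀ j →
    xAt ρ j ≡ xAt σ (j + s) × yAt ρ j ≡ yAt σ (j + s)

  Ttilde : Rel → Rel → Table
  Ttilde M0 Ms x y =
    T x y ≡ true ×
    (∃ λ x' → Ms x' y ≡ true × rankY y x' ≤ rankY y x) ×
    (∀ x' → M0 x' y ≡ true → rankY y x ≤ rankY y x') ×
    (∃ λ y' → M0 x y' ≡ true × rankX x y' ≤ rankX x y) ×
    (∀ y' → Ms x y' ≡ true → rankX x y ≤ rankX x y')

module Submission where

open import Data.Bool using (Bool; true; false) renaming (_≟_ to _≟ᵇ_)
open import Data.Bool.Properties using (T-≡)
open import Data.Empty using (⊥; ⊥-elim)
open import Data.Fin as Fin using (Fin; toℕ; fromℕ<; fromℕ)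
open import Data.Fin.Properties
  using ( toℕ-injective; toℕ-fromℕ<; toℕ<n; toℕ≤pred[n]; toℕ-inject; toℕ-fromℕ; pigeonhole
        ; ¬∀⟶∃¬-smallest; ¬∀⟶∃¬; any?; all?; cantor-schröder-bernstein)
  renaming (_≟_ to _≟ᶠ_)
open import Data.Nat using (ℕ; zero; suc; _+_; _*_; _∸_; _<_; _≤_; z≤n; s≤s; _<?_)
open import Data.Nat.DivMod using (_mod_; _%_; m<n⇒m%n≡m; n%n≡0; %-distribˡ-+; m%n%n≡m%n; [m+kn]%n≡m%n)
open import Data.Nat.GeneralisedArithmetic using (fold; fold-+)
open import Data.Nat.Properties
open import Data.Product using (∃; _×_; _,_; proj₁; proj₂)
open import Data.Sum using (_⊎_; inj₁; inj₂)
open import Function.Base using (_∘_)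
open import Function.Bundles using (Equivalence)
open import Function.Definitions using (Injective)
open import Relation.Binary.Definitions using (tri<; tri≈; tri>)
open import Relation.Binary.PropositionalEquality
open import Relation.Nullary using (¬_; Dec; yes; no; ¬?)
open import Relation.Nullary.Decidable using (⌊_⌋; toWitness; fromWitness; decidable-stable; _→-dec_; _×-dec_)
open import Relation.Unary using (Decidable)

open import Defs

-- For a stable matching N of T', the agents preferring their M0-partner to their N-partner
-- are mapped injectively into themselves by sending z to the N-partner of M0(z); being
-- finite, this map is onto. With the exposure condition of ρ this shows that no x_j is
-- N-matched strictly between y_j and y_{j+1}, and that x_j prefers y_j to N(x_j) either for
-- every j or for none. In part 1 every pair of ρg is a pair of ρ and the new edges of ρg lie
-- in T̃, so these two facts keep M1 = M0/ρg and the stable matchings of T' from blocking each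
-- other; the other claims are direct checks. In part 2 the agents with an M1-edge outside M0
-- all lie on ρ and are mapped injectively into themselves by sending z to the M0-partner of
-- M1(z); a cycle of this map is the required ρg, and it differs from ρ since otherwise
-- M1 = M0/ρ.

-- Orbits of an injective map on a finite set

module _ {m} {f : Fin m → Fin m} (f-injective : Injective _≡_ _≡_ f) where

  fold-injective : ∀ t → Injective _≡_ _≡_ (λ x → fold x f t)
  fold-injective zero    eq = eq
  fold-injective (suc t) eq = fold-injective t (f-injective eq)

  fold-returns : ∀ {s t} x → s < t → fold x f s ≡ fold x f t → fold x f (suc (t ∸ suc s)) ≡ x
  fold-returns {s} {t} x s<t eq = sym (fold-injective s (begin
    fold x f s                               ≡⟨ eq ⟩
    fold x f t                               ≡⟨ cong (fold x f) (sym (trans (+-suc s _) (m+[n∸m]≡n s<t))) ⟩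
    fold x f (s + suc (t ∸ suc s))           ≡⟨ fold-+ x f s ⟩
    fold (fold x f (suc (t ∸ suc s))) f s    ∎))
    where open ≡-Reasoning

  periodic : ∀ x → ∃ λ p → fold x f (suc p) ≡ x
  periodic x with pigeonhole (n<1+n m) (λ t → fold x f (toℕ t))
  ... | i , j , i<j , eq = toℕ j ∸ suc (toℕ i) , fold-returns x i<j eq

  injective⇒surjective : ∀ w → ∃ λ z → f z ≡ w
  injective⇒surjective w with periodic w
  ... | p , eq = fold w f p , eq

  minimal-period : ∀ x → ∃ λ q → fold x f (suc q) ≡ x × ∀ d → d < q → ¬ fold x f (suc d) ≡ x
  minimal-period x with periodic x
  ... | p , eq
    with ¬∀⟶∃¬-smallest (suc p) (λ i → ¬ fold x f (suc (toℕ i)) ≡ x) (λ i → ¬? (returns i))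
           (λ never → never (fromℕ p) (subst (λ t → fold x f (suc t) ≡ x) (sym (toℕ-fromℕ p)) eq))
    where
    returns : ∀ (i : Fin (suc p)) → Dec (fold x f (suc (toℕ i)) ≡ x)
    returns i = fold x f (suc (toℕ i)) ≟ᶠ x
  ... | i , ¬¬returns , earlier = toℕ i , decidable-stable (_ ≟ᶠ x) ¬¬returns , minimal
    where
    minimal : ∀ d → d < toℕ i → ¬ fold x f (suc d) ≡ x
    minimal d d<i = subst (λ t → ¬ fold x f (suc t) ≡ x) (trans (toℕ-inject j) (toℕ-fromℕ< d<i)) (earlier j)
      where j = fromℕ< d<i

  orbit-injective : ∀ x → ∃ λ q → fold x f (suc q) ≡ x × Injective _≡_ _≡_ (λ (i : Fin (suc q)) → fold x f (toℕ i))
  orbit-injective x with minimal-period x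
  ... | q , returns , minimal = q , returns , injective
    where
    distinct : ∀ (i j : Fin (suc q)) → toℕ i < toℕ j → ¬ fold x f (toℕ i) ≡ fold x f (toℕ j)
    distinct i j i<j eq = minimal (toℕ j ∸ suc (toℕ i)) d<q (fold-returns x i<j eq)
      where
      d<q : toℕ j ∸ suc (toℕ i) < q
      d<q = <-≤-trans (∸-monoʳ-< (s≤s z≤n) i<j) (toℕ≤pred[n] j)
    injective : Injective _≡_ _≡_ (λ (i : Fin (suc q)) → fold x f (toℕ i))
    injective {i} {j} eq with <-cmp (toℕ i) (toℕ j)
    ... | tri< i<j _ _ = ⊥-elim (distinct i j i<j eq)
    ... | tri≈ _ i≡j _ = toℕ-injective i≡j
    ... | tri> _ _ j<i = ⊥-elim (distinct j i j<i (sym eq))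

-- Cyclic indices; `next I` unfolds to suc-mod, so these lemmas apply to rotations.

suc-mod : ∀ {k} → Fin (suc k) → Fin (suc k)
suc-mod {k} i = suc (toℕ i) mod suc k

module _ {k : ℕ} where

  mod-cong : ∀ t u → t % suc k ≡ u % suc k → t mod suc k ≡ u mod suc k
  mod-cong t u eq = toℕ-injective (trans (toℕ-fromℕ< _) (trans eq (sym (toℕ-fromℕ< _))))

  toℕ-mod : ∀ (i : Fin (suc k)) → toℕ i mod suc k ≡ i
  toℕ-mod i = toℕ-injective (trans (toℕ-fromℕ< _) (m<n⇒m%n≡m (toℕ<n i)))

  +-toℕ-mod : ∀ u t → (u + toℕ (t mod suc k)) mod suc k ≡ (u + t) mod suc k
  +-toℕ-mod u t = mod-cong (u + toℕ (t mod suc k)) (u + t) (begin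
    (u + toℕ (t mod suc k)) % suc k               ≡⟨ cong (λ v → (u + v) % suc k) (toℕ-fromℕ< _) ⟩
    (u + t % suc k) % suc k                       ≡⟨ %-distribˡ-+ u (t % suc k) (suc k) ⟩
    (u % suc k + t % suc k % suc k) % suc k       ≡⟨ cong (λ v → (u % suc k + v) % suc k) (m%n%n≡m%n t (suc k)) ⟩
    (u % suc k + t % suc k) % suc k               ≡⟨ %-distribˡ-+ u t (suc k) ⟨
    (u + t) % suc k                               ∎)
    where open ≡-Reasoning

  suc-mod-mod : ∀ t → suc-mod (t mod suc k) ≡ suc t mod suc k
  suc-mod-mod = +-toℕ-mod 1

  mod-+-* : ∀ t c → (t + c * suc k) mod suc k ≡ t mod suc k
  mod-+-* t c = mod-cong (t + c * suc k) t ([m+kn]%n≡m%n t c (suc k))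

  pred-mod : Fin (suc k) → Fin (suc k)
  pred-mod i = (k + toℕ i) mod suc k

  suc-mod-pred-mod : ∀ i → suc-mod (pred-mod i) ≡ i
  suc-mod-pred-mod i = begin
    suc-mod ((k + toℕ i) mod suc k)     ≡⟨ suc-mod-mod (k + toℕ i) ⟩
    (suc k + toℕ i) mod suc k           ≡⟨ cong (_mod suc k) (+-comm (suc k) (toℕ i)) ⟩
    (toℕ i + suc k) mod suc k           ≡⟨ cong (λ t → (toℕ i + t) mod suc k) (sym (+-identityʳ (suc k))) ⟩
    (toℕ i + 1 * suc k) mod suc k       ≡⟨ mod-+-* (toℕ i) 1 ⟩
    toℕ i mod suc k                     ≡⟨ toℕ-mod i ⟩
    i                                   ∎
    where open ≡-Reasoning

  pred-mod-suc-mod : ∀ i → pred-mod (suc-mod i) ≡ i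
  pred-mod-suc-mod i = begin
    (k + toℕ (suc (toℕ i) mod suc k)) mod suc k   ≡⟨ +-toℕ-mod k (suc (toℕ i)) ⟩
    (k + suc (toℕ i)) mod suc k                   ≡⟨ cong (_mod suc k) (trans (+-suc k (toℕ i)) (+-comm (suc k) (toℕ i))) ⟩
    (toℕ i + suc k) mod suc k                     ≡⟨ cong (λ t → (toℕ i + t) mod suc k) (sym (+-identityʳ (suc k))) ⟩
    (toℕ i + 1 * suc k) mod suc k                 ≡⟨ mod-+-* (toℕ i) 1 ⟩
    toℕ i mod suc k                               ≡⟨ toℕ-mod i ⟩
    i                                             ∎
    where open ≡-Reasoning

  suc-mod-injective : Injective _≡_ _≡_ (suc-mod {k})
  suc-mod-injective {i} {j} eq = trans (sym (pred-mod-suc-mod i)) (trans (cong pred-mod eq) (pred-mod-suc-mod j))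

  suc-mod-view : ∀ (i : Fin (suc k)) → toℕ (suc-mod i) ≡ suc (toℕ i) ⊎ toℕ i ≡ k × suc-mod i ≡ Fin.zero
  suc-mod-view i with suc (toℕ i) <? suc k
  ... | yes i<k = inj₁ (trans (toℕ-fromℕ< _) (m<n⇒m%n≡m i<k))
  ... | no i≮k = inj₂ (i≡k , toℕ-injective (trans (toℕ-fromℕ< _) (trans (cong (λ t → suc t % suc k) i≡k) (n%n≡0 (suc k)))))
    where
    i≡k : toℕ i ≡ k
    i≡k = ≤-antisym (toℕ≤pred[n] i) (≤-pred (≮⇒≥ i≮k))

  fold-suc-mod : ∀ i t → fold i suc-mod t ≡ (toℕ i + t) mod suc k
  fold-suc-mod i zero    = sym (trans (cong (_mod suc k) (+-identityʳ (toℕ i))) (toℕ-mod i))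
  fold-suc-mod i (suc t) = begin
    suc-mod (fold i suc-mod t)          ≡⟨ cong suc-mod (fold-suc-mod i t) ⟩
    suc-mod ((toℕ i + t) mod suc k)     ≡⟨ suc-mod-mod (toℕ i + t) ⟩
    suc (toℕ i + t) mod suc k           ≡⟨ cong (_mod suc k) (sym (+-suc (toℕ i) t)) ⟩
    (toℕ i + suc t) mod suc k           ∎
    where open ≡-Reasoning

  suc-mod-closed : (Q : Fin (suc k) → Set) → (∀ i → Q i → Q (suc-mod i)) → ∀ i j → Q i → Q j
  suc-mod-closed Q step i j qi = subst Q reaches-j (reachable (toℕ j + (suc k ∸ toℕ i)))
    where
    reachable : ∀ t → Q (fold i suc-mod t)
    reachable zero    = qi
    reachable (suc t) = step _ (reachable t)
    distance : toℕ i + (toℕ j + (suc k ∸ toℕ i)) ≡ toℕ j + 1 * suc k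
    distance = begin
      toℕ i + (toℕ j + (suc k ∸ toℕ i))   ≡⟨ +-assoc (toℕ i) (toℕ j) _ ⟨
      toℕ i + toℕ j + (suc k ∸ toℕ i)     ≡⟨ cong (_+ (suc k ∸ toℕ i)) (+-comm (toℕ i) (toℕ j)) ⟩
      toℕ j + toℕ i + (suc k ∸ toℕ i)     ≡⟨ +-assoc (toℕ j) (toℕ i) _ ⟩
      toℕ j + (toℕ i + (suc k ∸ toℕ i))   ≡⟨ cong (toℕ j +_) (m+[n∸m]≡n (<⇒≤ (toℕ<n i))) ⟩
      toℕ j + suc k                       ≡⟨ cong (toℕ j +_) (+-identityʳ (suc k)) ⟨
      toℕ j + 1 * suc k                   ∎
      where open ≡-Reasoning
    reaches-j : fold i suc-mod (toℕ j + (suc k ∸ toℕ i)) ≡ j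
    reaches-j = trans (fold-suc-mod i _) (trans (cong (_mod suc k) distance) (trans (mod-+-* (toℕ j) 1) (toℕ-mod j)))

record Cycle {m} (A : Fin m → Set) (R : Fin m → Fin m → Set) : Set where
  field
    k              : ℕ
    node           : Fin (suc k) → Fin m
    node-injective : Injective _≡_ _≡_ node
    node-∈         : ∀ i → A (node i)
    node-step      : ∀ i → R (node i) (node (suc-mod i))

module Successors {m} {A : Fin m → Set} (A? : Decidable A) {R : Fin m → Fin m → Set}
  (successor : ∀ z → A z → ∃ λ w → A w × R z w)
  (R-injective : ∀ {z z' w} → R z w → R z' w → z ≡ z') where

  -- f extends the successor map by the identity outside A, an injective map on all of Fin m.
  private
    f : Fin m → Fin m
    f z with A? z
    ... | yes a = proj₁ (successor z a)
    ... | no _  = z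

    f-spec : ∀ z → A z × A (f z) × R z (f z) ⊎ ¬ A z × f z ≡ z
    f-spec z with A? z
    ... | yes a = inj₁ (a , proj₂ (successor z a))
    ... | no ¬a = inj₂ (¬a , refl)

    f-injective : Injective _≡_ _≡_ f
    f-injective {z} {z'} eq with f-spec z | f-spec z'
    ... | inj₁ (_ , _ , r)   | inj₁ (_ , _ , r')  = R-injective r (subst (R z') (sym eq) r')
    ... | inj₁ (_ , fa , _)  | inj₂ (¬a' , fix')  = ⊥-elim (¬a' (subst A (trans eq fix') fa))
    ... | inj₂ (¬a , fix)    | inj₁ (_ , fa' , _) = ⊥-elim (¬a (subst A (trans (sym eq) fix) fa'))
    ... | inj₂ (_ , fix)     | inj₂ (_ , fix')    = trans (sym fix) (trans eq fix')

    f-step : ∀ z → A z → A (f z) × R z (f z)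
    f-step z a with f-spec z
    ... | inj₁ (_ , step) = step
    ... | inj₂ (¬a , _)   = ⊥-elim (¬a a)

    fold-∈ : ∀ x t → A x → A (fold x f t)
    fold-∈ x zero    a = a
    fold-∈ x (suc t) a = proj₁ (f-step _ (fold-∈ x t a))

  -- Opaque: only the specifications matter, and unfolding these witnesses makes type checking slow.
  opaque
    predecessor : ∀ w → A w → ∃ λ z → A z × R z w
    predecessor w aw with injective⇒surjective f-injective w
    ... | z , fz≡w with f-spec z
    ... | inj₁ (az , _ , r) = z , az , subst (R z) fz≡w r
    ... | inj₂ (¬az , fix)  = ⊥-elim (¬az (subst A (sym (trans (sym fix) fz≡w)) aw))

    cycle : ∀ a → A a → Cycle A R
    cycle a aa with orbit-injective f-injective a
    ... | q , returns , injective = record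
      { k = q ; node = node ; node-injective = injective
      ; node-∈ = λ i → fold-∈ a (toℕ i) aa
      ; node-step = λ i → subst (R (node i)) (sym (node-suc-mod i)) (proj₂ (f-step _ (fold-∈ a (toℕ i) aa))) }
      where
      node : Fin (suc q) → Fin m
      node i = fold a f (toℕ i)
      node-suc-mod : ∀ i → node (suc-mod i) ≡ f (node i)
      node-suc-mod i with suc-mod-view i
      ... | inj₁ next≡suc        = cong (fold a f) next≡suc
      ... | inj₂ (i≡q , wraps)  = trans (cong node wraps) (sym (trans (cong (λ t → fold a f (suc t)) i≡q) returns))

≡true-ext : ∀ {a b : Bool} → (a ≡ true → b ≡ true) → (b ≡ true → a ≡ true) → a ≡ b
≡true-ext {true}  {true}  _ _ = refl
≡true-ext {true}  {false} f _ = sym (f refl)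
≡true-ext {false} {true}  _ g = g refl
≡true-ext {false} {false} _ _ = refl

module _ (I : Instance) where
  open Instance I

  module Matching {U : Table I} {M : Rel I} (isM : IsMatching I U M) where

    edge : ∀ {x y} → M x y ≡ true → U x y
    edge = proj₁ isM _ _

    unique-y : ∀ {x y y'} → M x y ≡ true → M x y' ≡ true → y ≡ y'
    unique-y = proj₁ (proj₂ isM) _ _ _

    unique-x : ∀ {x x' y} → M x y ≡ true → M x' y ≡ true → x ≡ x'
    unique-x = proj₂ (proj₂ isM) _ _ _

  rankX-≤∧≢⇒< : ∀ {x y y'} → T x y ≡ true → T x y' ≡ true → rankX x y ≤ rankX x y' → ¬ y ≡ y' → rankX x y < rankX x y'
  rankX-≤∧≢⇒< {x} t t' le ne = ≤∧≢⇒< le (λ eq → ne (rankX-inj x _ _ t t' eq))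

  rankY-≤∧≢⇒< : ∀ {y x x'} → T x y ≡ true → T x' y ≡ true → rankY y x ≤ rankY y x' → ¬ x ≡ x' → rankY y x < rankY y x'
  rankY-≤∧≢⇒< {y} t t' le ne = ≤∧≢⇒< le (λ eq → ne (rankY-inj y _ _ t t' eq))

  PrefX? : ∀ N x y → Dec (PrefX I N x y)
  PrefX? N x y = all? (λ y' → (N x y' ≟ᵇ true) →-dec (rankX x y <? rankX x y'))

  ¬PrefX⇒partner : ∀ N {x y} → ¬ PrefX I N x y → ∃ λ y' → N x y' ≡ true × rankX x y' ≤ rankX x y
  ¬PrefX⇒partner N {x} {y} ¬pref with ¬∀⟶∃¬ n _ (λ y' → (N x y' ≟ᵇ true) →-dec (rankX x y <? rankX x y')) ¬pref
  ... | y' , ¬better with N x y' ≟ᵇ true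
  ... | yes matched = y' , matched , ≮⇒≥ (λ lt → ¬better (λ _ → lt))
  ... | no unmatched = ⊥-elim (¬better (λ matched → ⊥-elim (unmatched matched)))

  ¬PrefY⇒partner : ∀ N {y x} → ¬ PrefY I N y x → ∃ λ x' → N x' y ≡ true × rankY y x' ≤ rankY y x
  ¬PrefY⇒partner N {y} {x} ¬pref with ¬∀⟶∃¬ m _ (λ x' → (N x' y ≟ᵇ true) →-dec (rankY y x <? rankY y x')) ¬pref
  ... | x' , ¬better with N x' y ≟ᵇ true
  ... | yes matched = x' , matched , ≮⇒≥ (λ lt → ¬better (λ _ → lt))
  ... | no unmatched = ⊥-elim (¬better (λ matched → ⊥-elim (unmatched matched)))

  module _ (M : Rel I) (σ : Rot I) where
    open Rot σ

    /-view : ∀ x →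
      (∃ λ i → xs i ≡ x × ∀ y → (_/_ I M σ) x y ≡ ⌊ y ≟ᶠ ys (suc-mod i) ⌋) ⊎
      ((∀ i → ¬ xs i ≡ x) × ∀ y → (_/_ I M σ) x y ≡ M x y)
    /-view x with any? (λ i → xs i ≟ᶠ x)
    ... | yes (i , eq) = inj₁ (i , eq , λ _ → refl)
    ... | no ¬on       = inj₂ ((λ i eq → ¬on (i , eq)) , λ _ → refl)

    /-on-rotation : ∀ i y → (_/_ I M σ) (xs i) y ≡ ⌊ y ≟ᶠ ys (suc-mod i) ⌋
    /-on-rotation i y with /-view (xs i)
    ... | inj₁ (i' , eq , rematched) with xs-inj i' i eq
    ... | refl = rematched y
    /-on-rotation i y | inj₂ (off , _) = ⊥-elim (off i refl)

    /-rematched : ∀ i → (_/_ I M σ) (xs i) (ys (suc-mod i)) ≡ true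
    /-rematched i = trans (/-on-rotation i _) (Equivalence.to T-≡ (fromWitness refl))

    /-rematched-only : ∀ i {y} → (_/_ I M σ) (xs i) y ≡ true → y ≡ ys (suc-mod i)
    /-rematched-only i {y} eq = toWitness (Equivalence.from T-≡ (trans (sym (/-on-rotation i y)) eq))

    /-edge : ∀ {x y} → (_/_ I M σ) x y ≡ true →
      (∃ λ i → xs i ≡ x × y ≡ ys (suc-mod i)) ⊎ ((∀ i → ¬ xs i ≡ x) × M x y ≡ true)
    /-edge {x} {y} eq with /-view x
    ... | inj₁ (i , refl , _) = inj₁ (i , refl , /-rematched-only i eq)
    ... | inj₂ (off , same)   = inj₂ (off , trans (sym (same y)) eq)

  module _ {U : Table I} {M : Rel I} {σ : Rot I} (isM : IsMatching I U M) (gen : GenExposed I U M σ) where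
    open Rot σ
    open Matching isM

    /-matching : IsMatching I U (_/_ I M σ)
    /-matching = (λ _ _ → edge′) , (λ _ _ _ → unique-y′) , (λ _ _ _ → unique-x′)
      where
      edge′ : ∀ {x y} → (_/_ I M σ) x y ≡ true → U x y
      edge′ e with /-edge M σ e
      ... | inj₁ (i , refl , refl) = proj₁ (proj₂ (gen i))
      ... | inj₂ (_ , e₀) = edge e₀
      unique-y′ : ∀ {x y y'} → (_/_ I M σ) x y ≡ true → (_/_ I M σ) x y' ≡ true → y ≡ y'
      unique-y′ e e' with /-edge M σ e | /-edge M σ e'
      ... | inj₁ (i , refl , refl) | inj₁ (i' , eq , refl) = cong (ys ∘ suc-mod) (xs-inj i i' (sym eq))
      ... | inj₁ (i , refl , _)    | inj₂ (off , _)       = ⊥-elim (off i refl)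
      ... | inj₂ (off , _)         | inj₁ (i , eq , _)    = ⊥-elim (off i eq)
      ... | inj₂ (_ , e₀)          | inj₂ (_ , e₀')       = unique-y e₀ e₀'
      unique-x′ : ∀ {x x' y} → (_/_ I M σ) x y ≡ true → (_/_ I M σ) x' y ≡ true → x ≡ x'
      unique-x′ e e' with /-edge M σ e | /-edge M σ e'
      ... | inj₁ (i , refl , refl) | inj₁ (i' , refl , eq) = cong xs (suc-mod-injective (ys-inj _ _ eq))
      ... | inj₁ (i , refl , refl) | inj₂ (off , e₀')      = ⊥-elim (off (suc-mod i) (unique-x (proj₁ (gen (suc-mod i))) e₀'))
      ... | inj₂ (off , e₀)        | inj₁ (i , refl , refl) = ⊥-elim (off (suc-mod i) (unique-x (proj₁ (gen (suc-mod i))) e₀))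
      ... | inj₂ (_ , e₀)          | inj₂ (_ , e₀')       = unique-x e₀ e₀'

  PrefY-/⇒PrefY : ∀ {U V M σ} → IsMatching I V M → GenExposed I U M σ → ∀ {y x} →
    PrefY I (_/_ I M σ) y x → PrefY I M y x
  PrefY-/⇒PrefY {σ = σ} isM gen {y} pref x' e with /-view _ σ x'
  ... | inj₂ (_ , same) = pref x' (trans (same y) e)
  ... | inj₁ (i , refl , _) with Matching.unique-y isM e (proj₁ (gen i))
  ... | refl with pred-mod i | suc-mod-pred-mod i
  ... | i' | refl = <-trans (pref (Rot.xs σ i') (/-rematched _ σ i')) (proj₁ (proj₂ (proj₂ (gen i'))))

  module _ (σ ρ : Rot I) where
    private
      module S = Rot σ
      module P = Rot ρ

    SameRot-intro : (j₀ : Fin (suc P.k)) → S.xs Fin.zero ≡ P.xs j₀ →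
      (∀ {i j} → S.xs i ≡ P.xs j → S.xs (suc-mod i) ≡ P.xs (suc-mod j)) →
      (∀ {i j} → S.xs i ≡ P.xs j → S.ys i ≡ P.ys j) → SameRot I σ ρ
    SameRot-intro j₀ start step same-y = k≡k , toℕ j₀ , λ t → aligned t , same-y (aligned t)
      where
      aligned : ∀ t → xAt I σ t ≡ xAt I ρ (t + toℕ j₀)
      aligned zero    = trans start (cong P.xs (sym (toℕ-mod j₀)))
      aligned (suc t) = trans (cong S.xs (sym (suc-mod-mod t)))
                        (trans (step (aligned t)) (cong P.xs (suc-mod-mod (t + toℕ j₀))))
      shift-back : Fin (suc P.k) → ℕ
      shift-back j = toℕ j + (suc P.k ∸ toℕ j₀)
      shift-back-+ : ∀ j → shift-back j + toℕ j₀ ≡ toℕ j + 1 * suc P.k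
      shift-back-+ j = trans (+-assoc (toℕ j) _ _)
        (cong (toℕ j +_) (trans (m∸n+n≡m (<⇒≤ (toℕ<n j₀))) (sym (+-identityʳ (suc P.k)))))
      covers : ∀ j → P.xs j ≡ S.xs (shift-back j mod suc S.k)
      covers j = sym (trans (aligned (shift-back j))
        (cong P.xs (trans (cong (_mod suc P.k) (shift-back-+ j)) (trans (mod-+-* (toℕ j) 1) (toℕ-mod j)))))
      forth-injective : Injective _≡_ _≡_ (λ (i : Fin (suc S.k)) → (toℕ i + toℕ j₀) mod suc P.k)
      forth-injective {i} {i'} eq = S.xs-inj i i' (begin
        S.xs i                                   ≡⟨ cong S.xs (toℕ-mod i) ⟨
        xAt I σ (toℕ i)                          ≡⟨ aligned (toℕ i) ⟩
        P.xs ((toℕ i + toℕ j₀) mod suc P.k)      ≡⟨ cong P.xs eq ⟩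
        P.xs ((toℕ i' + toℕ j₀) mod suc P.k)     ≡⟨ aligned (toℕ i') ⟨
        xAt I σ (toℕ i')                         ≡⟨ cong S.xs (toℕ-mod i') ⟩
        S.xs i'                                  ∎)
        where open ≡-Reasoning
      back-injective : Injective _≡_ _≡_ (λ j → shift-back j mod suc S.k)
      back-injective {j} {j'} eq = P.xs-inj j j' (trans (covers j) (trans (cong S.xs eq) (sym (covers j'))))
      k≡k : S.k ≡ P.k
      k≡k = suc-injective (cantor-schröder-bernstein forth-injective back-injective)

    SameRot-step : SameRot I σ ρ → ∀ l → ∃ λ i → S.xs i ≡ P.xs l × S.ys (suc-mod i) ≡ P.ys (suc-mod l)
    SameRot-step (_ , s , aligned) l = t mod suc S.k , same-x , same-y
      where
      t = toℕ l + s * P.k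
      t+s : t + s ≡ toℕ l + s * suc P.k
      t+s = begin
        toℕ l + s * P.k + s      ≡⟨ +-assoc (toℕ l) (s * P.k) s ⟩
        toℕ l + (s * P.k + s)    ≡⟨ cong (toℕ l +_) (+-comm (s * P.k) s) ⟩
        toℕ l + (s + s * P.k)    ≡⟨ cong (toℕ l +_) (*-suc s P.k) ⟨
        toℕ l + s * suc P.k      ∎
        where open ≡-Reasoning
      same-x : S.xs (t mod suc S.k) ≡ P.xs l
      same-x = trans (proj₁ (aligned t))
        (cong P.xs (trans (cong (_mod suc P.k) t+s) (trans (mod-+-* (toℕ l) s) (toℕ-mod l))))
      same-y : S.ys (suc-mod (t mod suc S.k)) ≡ P.ys (suc-mod l)
      same-y = trans (cong S.ys (suc-mod-mod t))
        (trans (proj₂ (aligned (suc t))) (cong P.ys (trans (cong (λ u → suc u mod suc P.k) t+s) (mod-+-* (suc (toℕ l)) s))))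

  module ExposedRotation (T' : Rel I) (ρ : Rot I) (M0 : Rel I)
    (T'⊆T : SubtableOf I (⟦_⟧ I T') (⟦_⟧ I T)) (exposed : Exposed I (⟦_⟧ I T') M0 ρ) where
    open Rot ρ

    M* : Rel I
    M* = _/_ I M0 ρ

    M0-stable : Stable I (⟦_⟧ I T') M0
    M0-stable = proj₁ exposed

    open Matching (proj₁ M0-stable) public
      renaming (edge to M0-edge; unique-y to M0-unique-y; unique-x to M0-unique-x)

    M0-unblocked : ∀ {x y} → T' x y ≡ true → ¬ BlocksE I M0 x y
    M0-unblocked = proj₂ M0-stable _ _

    inT : ∀ {x y} → T' x y ≡ true → T x y ≡ true
    inT = T'⊆T _ _

    ρ-gen : GenExposed I (⟦_⟧ I T') M0 ρ
    ρ-gen = proj₁ (proj₂ exposed)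

    ρ-matched : ∀ i → M0 (xs i) (ys i) ≡ true
    ρ-matched i = proj₁ (ρ-gen i)

    ρ-edge : ∀ i → T' (xs i) (ys (suc-mod i)) ≡ true
    ρ-edge i = proj₁ (proj₂ (ρ-gen i))

    ρ-y-gains : ∀ i → rankY (ys (suc-mod i)) (xs i) < rankY (ys (suc-mod i)) (xs (suc-mod i))
    ρ-y-gains i = proj₁ (proj₂ (proj₂ (ρ-gen i)))

    ρ-x-loses : ∀ i → rankX (xs i) (ys i) < rankX (xs i) (ys (suc-mod i))
    ρ-x-loses i = proj₂ (proj₂ (proj₂ (ρ-gen i)))

    -- Stated for any x equal to xs j, since callers often know x only up to such an equation.
    ρ-exposed : ∀ {j x y} → x ≡ xs j → T' x y ≡ true → rankX x (ys j) < rankX x y →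
      rankX x y < rankX x (ys (suc-mod j)) → ∃ λ x' → M0 x' y ≡ true × rankY y x' < rankY y x
    ρ-exposed {j} refl = proj₂ (proj₂ exposed) j _

    PrefY-M*⇒PrefY-M0 : ∀ {y x} → PrefY I M* y x → PrefY I M0 y x
    PrefY-M*⇒PrefY-M0 = PrefY-/⇒PrefY {U = ⟦_⟧ I T'} (proj₁ M0-stable) ρ-gen

    M*-stable : Stable I (⟦_⟧ I T') M*
    M*-stable = /-matching (proj₁ M0-stable) ρ-gen , λ x y → unblocked
      where
      unblocked : ∀ {x y} → T' x y ≡ true → ¬ BlocksE I M* x y
      unblocked {x} {y} t (x-pref , y-pref) with /-view M0 ρ x
      ... | inj₂ (_ , same) = M0-unblocked t ((λ y' e → x-pref y' (trans (same y') e)) , PrefY-M*⇒PrefY-M0 y-pref)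
      ... | inj₁ (i , refl , _) with <-cmp (rankX (xs i) y) (rankX (xs i) (ys i))
      ... | tri< y>ys _ _ = M0-unblocked t ((λ y' e → subst (λ y'' → rankX (xs i) y < rankX (xs i) y'') (M0-unique-y (ρ-matched i) e) y>ys) ,
                                            PrefY-M*⇒PrefY-M0 y-pref)
      ... | tri≈ _ same-rank _ with rankX-inj (xs i) y (ys i) (inT t) (inT (M0-edge (ρ-matched i))) same-rank
      ... | refl = <-irrefl refl (PrefY-M*⇒PrefY-M0 y-pref (xs i) (ρ-matched i))
      unblocked {x} {y} t (x-pref , y-pref) | inj₁ (i , refl , _) | tri> _ _ ys>y
        with ρ-exposed refl t ys>y (x-pref _ (/-rematched M0 ρ i))
      ... | x' , m0 , better = <-asym better (PrefY-M*⇒PrefY-M0 y-pref x' m0)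

    module AgainstStable (N : Rel I) (N-stable : Stable I (⟦_⟧ I T') N) where
      open Matching (proj₁ N-stable) public
        renaming (edge to N-edge; unique-y to N-unique-y; unique-x to N-unique-x)

      N-unblocked : ∀ {x y} → T' x y ≡ true → ¬ BlocksE I N x y
      N-unblocked = proj₂ N-stable _ _

      PrefersM0 : Fin m → Set
      PrefersM0 z = ∃ λ y → M0 z y ≡ true × PrefX I N z y

      PrefersM0? : ∀ z → Dec (PrefersM0 z)
      PrefersM0? z = any? (λ y → (M0 z y ≟ᵇ true) ×-dec PrefX? N z y)

      _⇝_ : Fin m → Fin m → Set
      z ⇝ w = ∃ λ y → M0 z y ≡ true × N w y ≡ true

      ⇝-injective : ∀ {z z' w} → z ⇝ w → z' ⇝ w → z ≡ z'
      ⇝-injective (y , m0 , n) (y' , m0' , n') with N-unique-y n n'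
      ... | refl = M0-unique-x m0 m0'

      holder-≥ : ∀ {x y} → T' x y ≡ true → PrefX I N x y → ∃ λ w → N w y ≡ true × rankY y w ≤ rankY y x
      holder-≥ t x-pref = ¬PrefY⇒partner N (λ y-pref → N-unblocked t (x-pref , y-pref))

      beats-M0-partner⇒PrefersM0 : ∀ {w z y} → N w y ≡ true → M0 z y ≡ true → rankY y w < rankY y z → PrefersM0 w
      beats-M0-partner⇒PrefersM0 {w} {z} {y} n m0 w>z
        with ¬PrefX⇒partner M0 (λ w-pref → M0-unblocked (N-edge n) (w-pref , y-pref))
        where
        y-pref : PrefY I M0 y w
        y-pref z' m0' = subst (λ z'' → rankY y w < rankY y z'') (M0-unique-x m0 m0') w>z
      ... | y₀ , m0w , y₀≥y = y₀ , m0w , λ y' n' →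
            subst (λ y'' → rankX w y₀ < rankX w y'') (N-unique-y n n')
              (rankX-≤∧≢⇒< (inT (M0-edge m0w)) (inT (N-edge n)) y₀≥y y₀≢y)
        where
        y₀≢y : ¬ y₀ ≡ y
        y₀≢y refl = <-irrefl (cong (rankY y) (M0-unique-x m0w m0)) w>z

      successor : ∀ z → PrefersM0 z → ∃ λ w → PrefersM0 w × z ⇝ w
      successor z (y₀ , m0 , z-pref) with holder-≥ (M0-edge m0) z-pref
      ... | w , n , w≥z = w , beats-M0-partner⇒PrefersM0 n m0 (rankY-≤∧≢⇒< (inT (N-edge n)) (inT (M0-edge m0)) w≥z w≢z) , y₀ , m0 , n
        where
        w≢z : ¬ w ≡ z
        w≢z refl = <-irrefl refl (z-pref y₀ n)

      open Successors PrefersM0? successor ⇝-injective using (predecessor)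

      no-partner-strictly-between : ∀ {j x y} → x ≡ xs j → N x y ≡ true →
        rankX x (ys j) < rankX x y → rankX x y < rankX x (ys (suc-mod j)) → ⊥
      no-partner-strictly-between {j} {y = y} refl n after before with ρ-exposed refl (N-edge n) after before
      ... | x , m0 , x>xs with predecessor (xs j) (ys j , ρ-matched j , λ y' n' → subst (λ y'' → _ < rankX (xs j) y'') (N-unique-y n n') after)
      ... | z , (y₀ , m0z , z-pref) , y₁ , m0z' , n₁ with N-unique-y n n₁
      ... | refl with M0-unique-x m0z' m0
      ... | refl with M0-unique-y m0 m0z
      ... | refl = N-unblocked (M0-edge m0) (z-pref , λ x' n' → subst (λ x'' → rankY y z < rankY y x'') (N-unique-x n n') x>xs)

      PrefersOwn : Fin (suc k) → Set
      PrefersOwn j = PrefX I N (xs j) (ys j)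

      PrefersOwn⇒next-≤ : ∀ {j y} → PrefersOwn j → N (xs j) y ≡ true → rankX (xs j) (ys (suc-mod j)) ≤ rankX (xs j) y
      PrefersOwn⇒next-≤ own n = ≮⇒≥ (no-partner-strictly-between refl n (own _ n))

      PrefersOwn-suc-mod : ∀ j → PrefersOwn j → PrefersOwn (suc-mod j)
      PrefersOwn-suc-mod j own with holder
        where
        holder : ∃ λ z → N z (ys (suc-mod j)) ≡ true × rankY (ys (suc-mod j)) z ≤ rankY (ys (suc-mod j)) (xs j)
        holder with N (xs j) (ys (suc-mod j)) ≟ᵇ true
        ... | yes n = xs j , n , ≤-refl
        ... | no ¬n = holder-≥ (ρ-edge j) λ y n →
              rankX-≤∧≢⇒< (inT (ρ-edge j)) (inT (N-edge n)) (PrefersOwn⇒next-≤ own n) (λ { refl → ¬n n })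
      ... | z , n , z≥xs = next-prefers (predecessor z z-prefers)
        where
        z-prefers : PrefersM0 z
        z-prefers with z ≟ᶠ xs j
        ... | yes refl = ys j , ρ-matched j , own
        ... | no z≢xs = beats-M0-partner⇒PrefersM0 n (ρ-matched (suc-mod j))
                          (<-trans (rankY-≤∧≢⇒< (inT (N-edge n)) (inT (ρ-edge j)) z≥xs z≢xs) (ρ-y-gains j))
        next-prefers : (∃ λ z' → PrefersM0 z' × z' ⇝ z) → PrefersOwn (suc-mod j)
        next-prefers (z' , (y₀ , m0 , z'-pref) , y , m0' , n') with N-unique-y n n'
        ... | refl with M0-unique-x m0' (ρ-matched (suc-mod j))
        ... | refl with M0-unique-y m0 (ρ-matched (suc-mod j))
        ... | refl = z'-pref

      PrefersOwn-all : ∀ j j' → PrefersOwn j → PrefersOwn j'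
      PrefersOwn-all = suc-mod-closed PrefersOwn PrefersOwn-suc-mod

    -- Part 1: a generalized rotation within T̃

    module GeneralizedRotation (σ : Rot I) (σ≉ρ : ¬ SameRot I σ ρ) (σ-gen : GenExposed I (Ttilde I M0 M*) M0 σ) where
      module S = Rot σ

      M1 : Rel I
      M1 = _/_ I M0 σ

      σ-matched : ∀ i → M0 (S.xs i) (S.ys i) ≡ true
      σ-matched i = proj₁ (σ-gen i)

      σ-in-T̃ : ∀ i → Ttilde I M0 M* (S.xs i) (S.ys (suc-mod i))
      σ-in-T̃ i = proj₁ (proj₂ (σ-gen i))

      σ-y-gains : ∀ i → rankY (S.ys (suc-mod i)) (S.xs i) < rankY (S.ys (suc-mod i)) (S.xs (suc-mod i))
      σ-y-gains i = proj₁ (proj₂ (proj₂ (σ-gen i)))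

      σ-x-loses : ∀ i → rankX (S.xs i) (S.ys i) < rankX (S.xs i) (S.ys (suc-mod i))
      σ-x-loses i = proj₂ (proj₂ (proj₂ (σ-gen i)))

      σ-edge : ∀ i → T (S.xs i) (S.ys (suc-mod i)) ≡ true
      σ-edge i = proj₁ (σ-in-T̃ i)

      σ-M*-holder : ∀ i → ∃ λ x → M* x (S.ys (suc-mod i)) ≡ true × rankY (S.ys (suc-mod i)) x ≤ rankY (S.ys (suc-mod i)) (S.xs i)
      σ-M*-holder i = proj₁ (proj₂ (σ-in-T̃ i))

      σ-below-M0-holder : ∀ i {x} → M0 x (S.ys (suc-mod i)) ≡ true → rankY (S.ys (suc-mod i)) (S.xs i) ≤ rankY (S.ys (suc-mod i)) x
      σ-below-M0-holder i = proj₁ (proj₂ (proj₂ (σ-in-T̃ i))) _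

      σ-above-M*-partner : ∀ i {y} → M* (S.xs i) y ≡ true → rankX (S.xs i) (S.ys (suc-mod i)) ≤ rankX (S.xs i) y
      σ-above-M*-partner i = proj₂ (proj₂ (proj₂ (proj₂ (σ-in-T̃ i)))) _

      σ-within-ρ : ∀ i → ∃ λ j → S.xs i ≡ xs j × S.ys i ≡ ys j ×
        rankX (S.xs i) (S.ys (suc-mod i)) ≤ rankX (S.xs i) (ys (suc-mod j))
      σ-within-ρ i with /-view M0 ρ (S.xs i)
      ... | inj₁ (j , eq , _) = j , sym eq , M0-unique-y (σ-matched i) (subst (λ x → M0 x (ys j) ≡ true) eq (ρ-matched j)) ,
                                σ-above-M*-partner i (subst (λ x → M* x (ys (suc-mod j)) ≡ true) eq (/-rematched M0 ρ j))
      ... | inj₂ (_ , same) = ⊥-elim (<⇒≱ (σ-x-loses i) (σ-above-M*-partner i (trans (same _) (σ-matched i))))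

      SameRot-if-successors-agree : (∀ {i j} → S.xs i ≡ xs j → S.ys (suc-mod i) ≡ ys (suc-mod j)) → SameRot I σ ρ
      SameRot-if-successors-agree agree =
        SameRot-intro σ ρ (proj₁ (σ-within-ρ Fin.zero)) (proj₁ (proj₂ (σ-within-ρ Fin.zero))) step same-y
        where
        same-y : ∀ {i j} → S.xs i ≡ xs j → S.ys i ≡ ys j
        same-y {i} {j} eq = M0-unique-y (σ-matched i) (subst (λ x → M0 x (ys j) ≡ true) (sym eq) (ρ-matched j))
        step : ∀ {i j} → S.xs i ≡ xs j → S.xs (suc-mod i) ≡ xs (suc-mod j)
        step {i} {j} eq = M0-unique-x (σ-matched (suc-mod i))
          (subst (λ y → M0 (xs (suc-mod j)) y ≡ true) (sym (agree eq)) (ρ-matched (suc-mod j)))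

      M1≺M0 : StrictX I M1 M0
      M1≺M0 = weaker , λ M1≐M0 → <-irrefl (cong (rankX (S.xs Fin.zero)) (/-rematched-only M0 σ Fin.zero (trans (M1≐M0 _ _) (σ-matched Fin.zero)))) (σ-x-loses Fin.zero)
        where
        weaker : WeakX I M1 M0
        weaker x y e with /-edge M0 σ e
        ... | inj₁ (i , refl , refl) = S.ys i , σ-matched i , <⇒≤ (σ-x-loses i)
        ... | inj₂ (_ , e₀) = y , e₀ , ≤-refl

      M*≺M1 : StrictX I M* M1
      M*≺M1 = weaker , λ M*≐M1 → σ≉ρ (SameRot-if-successors-agree λ {i} {j} eq →
                /-rematched-only M0 ρ j (subst (λ x → M* x (S.ys (suc-mod i)) ≡ true) eq (trans (M*≐M1 _ _) (/-rematched M0 σ i))))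
        where
        weaker : WeakX I M* M1
        weaker x y e with /-edge M0 ρ e | /-view M0 σ x
        ... | inj₂ (off , _) | inj₁ (i , refl , _) = ⊥-elim (off (proj₁ (σ-within-ρ i)) (sym (proj₁ (proj₂ (σ-within-ρ i)))))
        ... | inj₂ (_ , e₀)  | inj₂ (_ , same) = y , trans (same y) e₀ , ≤-refl
        ... | inj₁ (j , refl , refl) | inj₂ (_ , same) = ys j , trans (same _) (ρ-matched j) , <⇒≤ (ρ-x-loses j)
        ... | inj₁ (j , refl , refl) | inj₁ (i , eq , _) with σ-within-ρ i
        ... | j' , eq' , _ , ≤next with xs-inj j' j (trans (sym eq') eq)
        ... | refl = S.ys (suc-mod i) , subst (λ x → M1 x (S.ys (suc-mod i)) ≡ true) eq (/-rematched M0 σ i) ,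
                     subst (λ x → rankX x (S.ys (suc-mod i)) ≤ rankX x (ys (suc-mod j))) eq ≤next

      M0-stable-∪E : Stable I (_∪E_ I (⟦_⟧ I T') σ) M0
      M0-stable-∪E = ((λ x y e → inj₁ (M0-edge e)) , proj₂ (proj₁ M0-stable)) , unblocked
        where
        unblocked : ∀ x y → (_∪E_ I (⟦_⟧ I T') σ) x y → ¬ BlocksE I M0 x y
        unblocked x y (inj₁ t) = M0-unblocked t
        unblocked x y (inj₂ (i , refl , inj₁ refl)) (x-pref , _) = <-irrefl refl (x-pref (S.ys i) (σ-matched i))
        unblocked x y (inj₂ (i , refl , inj₂ refl)) (x-pref , _) = <-asym (x-pref (S.ys i) (σ-matched i)) (σ-x-loses i)

      σ-exposed-∪E : Exposed I (_∪E_ I (⟦_⟧ I T') σ) M0 σ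
      σ-exposed-∪E = M0-stable-∪E , (λ i → σ-matched i , inj₂ (i , refl , inj₂ refl) , σ-y-gains i , σ-x-loses i) , exposure
        where
        exposure : ∀ i y → (_∪E_ I (⟦_⟧ I T') σ) (S.xs i) y → rankX (S.xs i) (S.ys i) < rankX (S.xs i) y →
          rankX (S.xs i) y < rankX (S.xs i) (S.ys (suc-mod i)) → ∃ λ x → M0 x y ≡ true × rankY y x < rankY y (S.xs i)
        exposure i y (inj₂ (i' , eq , inj₁ refl)) after _ with S.xs-inj i' i eq
        ... | refl = ⊥-elim (<-irrefl refl after)
        exposure i y (inj₂ (i' , eq , inj₂ refl)) _ before with S.xs-inj i' i eq
        ... | refl = ⊥-elim (<-irrefl refl before)
        exposure i y (inj₁ t) after before with σ-within-ρ i
        ... | j , on-ρ , same-y , ≤next =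
          ρ-exposed on-ρ t (subst (λ y₀ → rankX (S.xs i) y₀ < rankX (S.xs i) y) same-y after) (<-≤-trans before ≤next)

      -- Where σ leaves ρ, the exposure of ρ yields an M0-edge that blocks M1.
      M1-unstable : ¬ Stable I (⟦_⟧ I T') M1
      M1-unstable M1-stable = σ≉ρ (SameRot-if-successors-agree agree)
        where
        open Matching (proj₁ M1-stable) renaming (edge to M1-edge; unique-x to M1-unique-x)
        agree : ∀ {i j} → S.xs i ≡ xs j → S.ys (suc-mod i) ≡ ys (suc-mod j)
        agree {i} {j} eq with σ-within-ρ i
        ... | j' , eq' , same-y , ≤next with xs-inj j' j (trans (sym eq') eq)
        ... | refl with S.ys (suc-mod i) ≟ᶠ ys (suc-mod j')
        ... | yes same = same
        ... | no differ with ρ-exposed eq' (M1-edge (/-rematched M0 σ i)) (subst (λ y₀ → rankX (S.xs i) y₀ < rankX (S.xs i) (S.ys (suc-mod i))) same-y (σ-x-loses i))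
                                (rankX-≤∧≢⇒< (σ-edge i) (subst (λ x → T x (ys (suc-mod j')) ≡ true) (sym eq') (inT (ρ-edge j'))) ≤next differ)
        ... | x , m0 , x>xs = ⊥-elim (proj₂ M1-stable x _ (M0-edge m0) (x-pref , y-pref))
          where
          y-pref : PrefY I M1 (S.ys (suc-mod i)) x
          y-pref x' e = subst (λ x'' → rankY _ x < rankY _ x'') (M1-unique-x (/-rematched M0 σ i) e) x>xs
          x-pref : PrefX I M1 x (S.ys (suc-mod i))
          x-pref y' e with proj₁ M1≺M0 x y' e
          ... | y'' , m0' , ≤y' with M0-unique-y m0' m0
          ... | refl = rankX-≤∧≢⇒< (inT (M0-edge m0)) (inT (M1-edge e)) ≤y' λ { refl →
                         <-irrefl (cong (rankY _) (M1-unique-x e (/-rematched M0 σ i))) x>xs }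

      PrefY-M1⇒PrefY-M0 : ∀ {y x} → PrefY I M1 y x → PrefY I M0 y x
      PrefY-M1⇒PrefY-M0 = PrefY-/⇒PrefY {U = Ttilde I M0 M*} (proj₁ M0-stable) σ-gen

      module AgainstStableMatching (N : Rel I) (N-stable : Stable I (⟦_⟧ I T') N) where
        open AgainstStable N N-stable

        stable-edge-unblocking : ∀ {x y} → N x y ≡ true → ¬ BlocksE I M1 x y
        stable-edge-unblocking {x} {y} n (x-pref , y-pref) with /-view M0 σ x
        ... | inj₂ (_ , same) = M0-unblocked (N-edge n) ((λ y' e → x-pref y' (trans (same y') e)) , PrefY-M1⇒PrefY-M0 y-pref)
        ... | inj₁ (i , refl , _) with <-cmp (rankX (S.xs i) y) (rankX (S.xs i) (S.ys i))
        ... | tri< y>ys _ _ = M0-unblocked (N-edge n)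
                ((λ y' e → subst (λ y'' → rankX (S.xs i) y < rankX (S.xs i) y'') (M0-unique-y (σ-matched i) e) y>ys) , PrefY-M1⇒PrefY-M0 y-pref)
        ... | tri≈ _ same-rank _ with rankX-inj (S.xs i) y (S.ys i) (inT (N-edge n)) (inT (M0-edge (σ-matched i))) same-rank
        ... | refl = <-irrefl refl (PrefY-M1⇒PrefY-M0 y-pref (S.xs i) (σ-matched i))
        stable-edge-unblocking {x} {y} n (x-pref , y-pref) | inj₁ (i , refl , _) | tri> _ _ ys>y with σ-within-ρ i
        ... | j , on-ρ , same-y , ≤next = no-partner-strictly-between on-ρ n
                (subst (λ y₀ → rankX (S.xs i) y₀ < rankX (S.xs i) y) same-y ys>y)
                (<-≤-trans (x-pref _ (/-rematched M0 σ i)) ≤next)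

        -- The M*-holder of y = S.ys (suc-mod i) is some xs l, and (xs l , y) would block N.
        σ-edge-unblocking : ∀ {i j} → S.xs i ≡ xs j → S.ys i ≡ ys j → ¬ S.ys (suc-mod i) ≡ ys (suc-mod j) →
          ¬ BlocksE I N (S.xs i) (S.ys (suc-mod i))
        σ-edge-unblocking {i} {j} on-ρ same-y differ (x-pref , y-pref) with σ-M*-holder i
        ... | x' , e , x'≥xs with /-edge M0 ρ e
        ... | inj₂ (off , m0) = off j (trans (sym on-ρ)
                (rankY-inj _ _ _ (σ-edge i) (inT (M0-edge m0)) (≤-antisym (σ-below-M0-holder i m0) x'≥xs)))
        ... | inj₁ (l , refl , on-l) = N-unblocked t (xs-pref , yn-pref)
          where
          yn = S.ys (suc-mod i)
          t : T' (xs l) yn ≡ true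
          t = subst (λ y → T' (xs l) y ≡ true) (sym on-l) (ρ-edge l)
          xs-l>xs : rankY yn (xs l) < rankY yn (S.xs i)
          xs-l>xs = rankY-≤∧≢⇒< (inT t) (σ-edge i) x'≥xs
                      λ eq → differ (trans on-l (cong (ys ∘ suc-mod) (xs-inj l j (trans eq on-ρ))))
          own-j : PrefersOwn j
          own-j y' n' = subst₂ (λ x y₀ → rankX x y₀ < rankX x y') on-ρ same-y
                          (<-trans (σ-x-loses i) (x-pref y' (subst (λ x → N x y' ≡ true) (sym on-ρ) n')))
          yn-pref : PrefY I N yn (xs l)
          yn-pref x'' n'' = <-trans xs-l>xs (y-pref x'' n'')
          xs-pref : PrefX I N (xs l) yn
          xs-pref y'' n'' = rankX-≤∧≢⇒< (inT t) (inT (N-edge n''))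
            (subst (λ y → rankX (xs l) y ≤ rankX (xs l) y'') (sym on-l) (PrefersOwn⇒next-≤ (PrefersOwn-all j l own-j) n''))
            λ { refl → <-asym xs-l>xs (y-pref (xs l) n'') }

        M1-edge-unblocking : ∀ {x y} → M1 x y ≡ true → ¬ BlocksE I N x y
        M1-edge-unblocking e with /-edge M0 σ e
        ... | inj₂ (_ , m0) = N-unblocked (M0-edge m0)
        ... | inj₁ (i , refl , refl) with σ-within-ρ i
        ... | j , on-ρ , same-y , _ with S.ys (suc-mod i) ≟ᶠ ys (suc-mod j)
        ... | yes same = N-unblocked (subst₂ (λ x y → T' x y ≡ true) (sym on-ρ) (sym same) (ρ-edge j))
        ... | no differ = σ-edge-unblocking on-ρ same-y differ

      internally-stable : InternallyStable I (λ M → _≐_ I M M1 ⊎ Stable I (⟦_⟧ I T') M)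
      internally-stable M M' (inj₁ M≐M1) (inj₁ M'≐M1) (x , y , e , x-pref , _) =
        <-irrefl refl (x-pref y (trans (M≐M1 x y) (trans (sym (M'≐M1 x y)) e)))
      internally-stable M M' (inj₂ M-stable) (inj₂ M'-stable) (x , y , e , blocks) =
        proj₂ M-stable x y (proj₁ (proj₁ M'-stable) x y e) blocks
      internally-stable M M' (inj₁ M≐M1) (inj₂ M'-stable) (x , y , e , x-pref , y-pref) =
        AgainstStableMatching.stable-edge-unblocking M' M'-stable e
          ((λ y' e' → x-pref y' (trans (M≐M1 x y') e')) , (λ x' e' → y-pref x' (trans (M≐M1 x' y) e')))
      internally-stable M M' (inj₂ M-stable) (inj₁ M'≐M1) (x , y , e , blocks) =
        AgainstStableMatching.M1-edge-unblocking M M-stable (trans (sym (M'≐M1 x y)) e) blocks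

    -- Part 2: a matching strictly between M* and M0

    module IntermediateMatching (M1 : Rel I) (M1-matching : IsMatching I (⟦_⟧ I T) M1)
      (M1≺M0 : StrictX I M1 M0) (M*≺M1 : StrictX I M* M1)
      (stable-set : InternallyStable I (λ M → _≐_ I M M1 ⊎ Stable I (⟦_⟧ I T') M)) where
      open Matching M1-matching renaming (edge to M1-edge; unique-y to M1-unique-y; unique-x to M1-unique-x)

      M1-unblocking-M* : ¬ BlocksM I M1 M*
      M1-unblocking-M* = stable-set M* M1 (inj₂ M*-stable) (inj₁ (λ _ _ → refl))

      M0-unblocking-M1 : ¬ BlocksM I M0 M1
      M0-unblocking-M1 = stable-set M1 M0 (inj₁ (λ _ _ → refl)) (inj₂ M0-stable)

      squeezed : ∀ {x} → (∀ y → M* x y ≡ M0 x y) → ∀ y → M1 x y ≡ M0 x y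
      squeezed {x} M*≡M0 y = ≡true-ext to from
        where
        to : M1 x y ≡ true → M0 x y ≡ true
        to e with proj₁ M1≺M0 x y e
        ... | y₀ , m0 , y₀≥y with proj₁ M*≺M1 x y₀ (trans (M*≡M0 y₀) m0)
        ... | y₁ , e₁ , y₁≥y₀ with M1-unique-y e e₁
        ... | refl = subst (λ y' → M0 x y' ≡ true) (rankX-inj x _ _ (inT (M0-edge m0)) (M1-edge e) (≤-antisym y₀≥y y₁≥y₀)) m0
        from : M0 x y ≡ true → M1 x y ≡ true
        from m0 with proj₁ M*≺M1 x y (trans (M*≡M0 y) m0)
        ... | y₁ , e₁ , y₁≥y with proj₁ M1≺M0 x y₁ e₁
        ... | y₀ , m0' , y₀≥y₁ with M0-unique-y m0 m0'
        ... | refl = subst (λ y' → M1 x y' ≡ true) (rankX-inj x _ _ (M1-edge e₁) (inT (M0-edge m0)) (≤-antisym y₁≥y y₀≥y₁)) e₁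

      M1-within-ρ : ∀ j → ∃ λ y → M1 (xs j) y ≡ true × rankX (xs j) (ys j) ≤ rankX (xs j) y × rankX (xs j) y ≤ rankX (xs j) (ys (suc-mod j))
      M1-within-ρ j with proj₁ M*≺M1 (xs j) _ (/-rematched M0 ρ j)
      ... | y , e , ≤next with proj₁ M1≺M0 _ y e
      ... | y₀ , m0 , ≤y with M0-unique-y (ρ-matched j) m0
      ... | refl = y , e , ≤y , ≤next

      NewEdge : Fin m → Fin n → Set
      NewEdge z y = M1 z y ≡ true × ¬ M0 z y ≡ true

      NewEdge-on-ρ : ∀ {z y} → NewEdge z y → ∃ λ j → xs j ≡ z × rankX z (ys j) < rankX z y × rankX z y ≤ rankX z (ys (suc-mod j))
      NewEdge-on-ρ {z} {y} (e , ¬m0) with /-view M0 ρ z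
      ... | inj₂ (_ , same) = ⊥-elim (¬m0 (trans (sym (squeezed same y)) e))
      ... | inj₁ (j , refl , _) with M1-within-ρ j
      ... | y₁ , e₁ , ≤y₁ , ≤next with M1-unique-y e e₁
      ... | refl = j , refl , rankX-≤∧≢⇒< (inT (M0-edge (ρ-matched j))) (M1-edge e) ≤y₁ (λ { refl → ¬m0 (ρ-matched j) }) , ≤next

      NewEdge-M*-holder : ∀ {z y} → NewEdge z y → ∃ λ x → M* x y ≡ true × rankY y x ≤ rankY y z
      NewEdge-M*-holder {z} {y} new with NewEdge-on-ρ new
      ... | j , refl , _ , ≤next with y ≟ᶠ ys (suc-mod j)
      ... | yes refl = xs j , /-rematched M0 ρ j , ≤-refl
      ... | no differ = ¬PrefY⇒partner M* (λ y-pref → M1-unblocking-M* (xs j , y , proj₁ new , x-pref , y-pref))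
        where
        x-pref : PrefX I M* (xs j) y
        x-pref y' e with /-rematched-only M0 ρ j e
        ... | refl = rankX-≤∧≢⇒< (M1-edge (proj₁ new)) (inT (ρ-edge j)) ≤next differ

      NewEdge-below-M0-holder : ∀ {z y x} → NewEdge z y → M0 x y ≡ true → rankY y z ≤ rankY y x
      NewEdge-below-M0-holder {z} {y} {x} (e , ¬m0) m0 = ≮⇒≥ λ x>z → M0-unblocking-M1 (x , y , m0 , x-pref , y-pref x>z)
        where
        y-pref : rankY y x < rankY y z → PrefY I M1 y x
        y-pref x>z x' e' = subst (λ x'' → rankY y x < rankY y x'') (M1-unique-x e e') x>z
        x-pref : PrefX I M1 x y
        x-pref y' e' with proj₁ M1≺M0 x y' e'
        ... | y₀ , m0' , ≤y' with M0-unique-y m0' m0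
        ... | refl = rankX-≤∧≢⇒< (inT (M0-edge m0)) (M1-edge e') ≤y'
                       λ { refl → ¬m0 (subst (λ x'' → M0 x'' y ≡ true) (M1-unique-x e' e) m0) }

      NewEdge-in-T̃ : ∀ {z y} → NewEdge z y → Ttilde I M0 M* z y
      NewEdge-in-T̃ {z} {y} new with NewEdge-on-ρ new
      ... | j , refl , ys<y , ≤next =
        M1-edge (proj₁ new) , NewEdge-M*-holder new , (λ x → NewEdge-below-M0-holder new) ,
        (ys j , ρ-matched j , <⇒≤ ys<y) , λ y' e → subst (λ y'' → rankX (xs j) y ≤ rankX (xs j) y'') (sym (/-rematched-only M0 ρ j e)) ≤next

      HasNewEdge : Fin m → Set
      HasNewEdge z = ∃ (NewEdge z)

      HasNewEdge? : ∀ z → Dec (HasNewEdge z)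
      HasNewEdge? z = any? (λ y → (M1 z y ≟ᵇ true) ×-dec ¬? (M0 z y ≟ᵇ true))

      _↦_ : Fin m → Fin m → Set
      z ↦ w = ∃ λ y → M1 z y ≡ true × M0 w y ≡ true

      ↦-injective : ∀ {z z' w} → z ↦ w → z' ↦ w → z ≡ z'
      ↦-injective (y , e , m0) (y' , e' , m0') with M0-unique-y m0 m0'
      ... | refl = M1-unique-x e e'

      M*-matched⇒M0-matched : ∀ {x y} → M* x y ≡ true → ∃ λ w → M0 w y ≡ true
      M*-matched⇒M0-matched e with /-edge M0 ρ e
      ... | inj₁ (j , _ , refl) = xs (suc-mod j) , ρ-matched (suc-mod j)
      ... | inj₂ (_ , m0) = _ , m0

      successor : ∀ z → HasNewEdge z → ∃ λ w → HasNewEdge w × z ↦ w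
      successor z (y , new) with NewEdge-M*-holder new
      ... | x , e , _ with M*-matched⇒M0-matched e
      ... | w , m0 = w , w-new , y , proj₁ new , m0
        where
        w≢z : ¬ w ≡ z
        w≢z refl = proj₂ new m0
        w-new : HasNewEdge w
        w-new with /-view M0 ρ w
        ... | inj₂ (_ , same) = ⊥-elim (w≢z (M1-unique-x (trans (squeezed same y) m0) (proj₁ new)))
        ... | inj₁ (j , refl , _) with M1-within-ρ j
        ... | y₁ , e₁ , _ = y₁ , e₁ , λ m0₁ → w≢z (M1-unique-x (subst (λ y' → M1 (xs j) y' ≡ true) (M0-unique-y m0₁ m0) e₁) (proj₁ new))

      open Successors HasNewEdge? successor ↦-injective using (cycle)

      opaque
        some-NewEdge : ∃ HasNewEdge
        some-NewEdge with ¬∀⟶∃¬ m _ (λ x → all? (λ y → M1 x y ≟ᵇ M0 x y)) (proj₂ M1≺M0)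
        ... | x , differs with /-view M0 ρ x
        ... | inj₂ (_ , same) = ⊥-elim (differs (squeezed same))
        ... | inj₁ (j , refl , _) with M1-within-ρ j
        ... | y , e , _ with M0 (xs j) y ≟ᵇ true
        ... | no ¬m0 = xs j , y , e , ¬m0
        ... | yes m0 = ⊥-elim (differs λ y' → ≡true-ext
                (λ e' → subst (λ y'' → M0 (xs j) y'' ≡ true) (M1-unique-y e e') m0)
                (λ m0' → subst (λ y'' → M1 (xs j) y'' ≡ true) (M0-unique-y m0 m0') e))

        new-edge-cycle : Cycle HasNewEdge _↦_
        new-edge-cycle = cycle (proj₁ some-NewEdge) (proj₂ some-NewEdge)

      open Cycle new-edge-cycle using (node; node-injective; node-∈; node-step)

      opaque
        M0-partner : ∀ i → ∃ λ y → M0 (node i) y ≡ true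
        M0-partner i with NewEdge-on-ρ (proj₂ (node-∈ i))
        ... | j , on-ρ , _ = ys j , subst (λ x → M0 x (ys j) ≡ true) on-ρ (ρ-matched j)

      ρg : Rot I
      ρg = record
        { k = Cycle.k new-edge-cycle ; xs = node ; ys = λ i → proj₁ (M0-partner i)
        ; xs-inj = λ _ _ → node-injective
        ; ys-inj = λ i j eq → node-injective (M0-unique-x (proj₂ (M0-partner i))
                     (subst (λ y → M0 (node j) y ≡ true) (sym eq) (proj₂ (M0-partner j)))) }

      ρg-step : ∀ i → M1 (node i) (Rot.ys ρg (suc-mod i)) ≡ true
      ρg-step i = subst (λ y → M1 (node i) y ≡ true)
        (M0-unique-y (proj₂ (proj₂ (node-step i))) (proj₂ (M0-partner (suc-mod i)))) (proj₁ (proj₂ (node-step i)))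

      ρg-gen : GenExposed I (Ttilde I M0 M*) M0 ρg
      ρg-gen i = m0 , NewEdge-in-T̃ new , y-gains , x-loses
        where
        z = node i
        w = node (suc-mod i)
        y₀ = proj₁ (M0-partner i)
        y = proj₁ (M0-partner (suc-mod i))
        m0 : M0 z y₀ ≡ true
        m0 = proj₂ (M0-partner i)
        m0w : M0 w y ≡ true
        m0w = proj₂ (M0-partner (suc-mod i))
        new : NewEdge z y
        new with node-∈ i
        ... | y' , e' , ¬m0' = ρg-step i , λ m0'' → ¬m0' (subst (λ y'' → M0 z y'' ≡ true) (M1-unique-y (ρg-step i) e') m0'')
        y-gains : rankY y z < rankY y w
        y-gains = rankY-≤∧≢⇒< (M1-edge (ρg-step i)) (inT (M0-edge m0w)) (NewEdge-below-M0-holder new m0w)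
                    λ eq → proj₂ new (subst (λ x → M0 x y ≡ true) (sym eq) m0w)
        x-loses : rankX z y₀ < rankX z y
        x-loses with NewEdge-on-ρ new
        ... | j , on-ρ , ys<y , _ =
          subst (λ y'' → rankX z y'' < rankX z y) (M0-unique-y (subst (λ x → M0 x (ys j) ≡ true) on-ρ (ρ-matched j)) m0) ys<y

      ρg≉ρ : ¬ SameRot I ρg ρ
      ρg≉ρ ρg≈ρ = proj₂ M*≺M1 agree
        where
        agree : ∀ x y → M* x y ≡ M1 x y
        agree x y with /-view M0 ρ x
        ... | inj₂ (_ , same) = trans (same y) (sym (squeezed same y))
        ... | inj₁ (l , refl , _) = ≡true-ext
          (λ e → subst (λ y' → M1 (xs l) y' ≡ true) (sym (/-rematched-only M0 ρ l e)) rematched)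
          (λ e → subst (λ y' → M* (xs l) y' ≡ true) (M1-unique-y rematched e) (/-rematched M0 ρ l))
          where
          rematched : M1 (xs l) (ys (suc-mod l)) ≡ true
          rematched with SameRot-step ρg ρ ρg≈ρ l
          ... | i , on-l , next-l = subst₂ (λ x y' → M1 x y' ≡ true) on-l next-l (ρg-step i)

lemma8 : (I : Instance) (T' : Rel I) (ρ : Rot I) (M0 : Rel I) →
    SubtableOf I (⟦_⟧ I T') (⟦_⟧ I (Instance.T I)) →
    StableTable I (⟦_⟧ I T') →
    Exposed I (⟦_⟧ I T') M0 ρ →
    ((ρg : Rot I) → ¬ SameRot I ρg ρ →
      GenExposed I (Ttilde I M0 (_/_ I M0 ρ)) M0 ρg →
      ¬ Stable I (⟦_⟧ I T') (_/_ I M0 ρg) ×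
      InternallyStable I (λ M → _≐_ I M (_/_ I M0 ρg) ⊎ Stable I (⟦_⟧ I T') M) ×
      StrictX I (_/_ I M0 ρg) M0 ×
      StrictX I (_/_ I M0 ρ) (_/_ I M0 ρg) ×
      Stable I (_∪E_ I (⟦_⟧ I T') ρg) M0 ×
      InRX I (_∪E_ I (⟦_⟧ I T') ρg) ρg ×
      Exposed I (_∪E_ I (⟦_⟧ I T') ρg) M0 ρg) ×
    ((M1 : Rel I) → IsMatching I (⟦_⟧ I (Instance.T I)) M1 →
      StrictX I M1 M0 → StrictX I (_/_ I M0 ρ) M1 →
      InternallyStable I (λ M → _≐_ I M M1 ⊎ Stable I (⟦_⟧ I T') M) →
      ∃ λ ρg → ¬ SameRot I ρg ρ × GenExposed I (Ttilde I M0 (_/_ I M0 ρ)) M0 ρg)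
lemma8 I T' ρ M0 T'⊆T _ exposed =
  (λ ρg ρg≉ρ ρg-gen → let open GeneralizedRotation ρg ρg≉ρ ρg-gen in
     M1-unstable , internally-stable , M1≺M0 , M*≺M1 , M0-stable-∪E , (M0 , σ-exposed-∪E) , σ-exposed-∪E) ,
  (λ M1 M1-matching M1≺M0 M*≺M1 stable-set → let open IntermediateMatching M1 M1-matching M1≺M0 M*≺M1 stable-set in
     ρg , ρg≉ρ , ρg-gen)
  where open ExposedRotation I T' ρ M0 T'⊆T exposed
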